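{- Let $\Phi$ be an irreducible root system of rank $\ell$, let $0\le i\le\ell$, and let $q$ be an integer with $q>c_i$. Let $F_0=q\bar A\cap H_{\tilde\alpha,q}$ and $F_j=q\bar A\cap H_{\alpha_j,0}$ for $1\le j\le\ell$ be the facets of $q\bar A$. Then $$\#\big((q\bar A\cap Z(\Phi))\setminus F_i\big)=L_{\bar A}(q-c_i).$$
   Context: Let $V=\mathbb{R}^\ell$ with inner product $(\cdot,\cdot)$, $\Phi\subset V$ an irreducible crystallographic root system with positive system $\Phi^+$, simple roots $\alpha_1,\dots,\alpha_\ell$. Highest root $\tilde\alpha=\sum_{i=1}^\ell c_i\alpha_i$ ($c_i\in\mathbb{Z}_{>0}$), $c_0=1$. $H_{\alpha,k}=\{x\mid(\alpha,x)=k\}$. Coweight lattice $Z(\Phi)=\{x\mid(\alpha_i,x)\in\mathbb{Z}\ \forall i\}$. Closed fundamental alcove $\bar A=\{x\mid(\alpha_i,x)\ge0\ (1\le i\le\ell),\ (\tilde\alpha,x)\le1\}$; $L_{\bar A}(q)=\#(q\bar A\cap Z(\Phi))$, a quasi-polynomial in $q$ extended to all integers.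
   Formalization: The Euclidean space V is ℚ^ℓ rather than ℝ^ℓ, with its inner product given by a symmetric positive-definite matrix with rational entries. -}

module Defs where

open import Data.Nat using (ℕ; zero; suc)
open import Data.Integer as ℤ using (ℤ; +_)
open import Data.Rational as ℚ using (ℚ; 0ℚ; 1ℚ; _+_; _*_; _-_; -_; _/_)
open import Data.Fin using (Fin; zero; suc)
open import Data.Vec using (Vec; lookup; replicate; zipWith; map)
open import Data.List using (List; length)
import Data.List as List
open import Data.List.Membership.Propositional using (_∈_)
open import Data.List.Relation.Unary.Unique.Propositional using (Unique)
open import Data.Product using (Σ; ∃; _×_; _,_)
open import Data.Sum using (_⊎_)
open import Data.Bool using (Bool; true; false)
open import Relation.Binary.PropositionalEquality using (_≡_; _≢_)
open import Relation.Nullary using (¬_)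

-- The ambient space V, realised as ℚ^ℓ.
Vect : ℕ → Set
Vect ℓ = Vec ℚ ℓ

ι : ℤ → ℚ
ι z = z / 1

zeroV : ∀ {ℓ} → Vect ℓ
zeroV {ℓ} = replicate ℓ 0ℚ

_⊕_ : ∀ {ℓ} → Vect ℓ → Vect ℓ → Vect ℓ
_⊕_ = zipWith _+_

_⊖_ : ∀ {ℓ} → Vect ℓ → Vect ℓ → Vect ℓ
_⊖_ = zipWith _-_

scale : ∀ {ℓ} → ℚ → Vect ℓ → Vect ℓ
scale a = map (a *_)

sumFin : ∀ {n} → (Fin n → ℚ) → ℚ
sumFin {zero}  f = 0ℚ
sumFin {suc n} f = f zero + sumFin (λ k → f (suc k))

lincomb : ∀ {n ℓ} → (Fin n → ℚ) → (Fin n → Vect ℓ) → Vect ℓ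
lincomb {zero}  a v = zeroV
lincomb {suc n} a v = scale (a zero) (v zero) ⊕ lincomb (λ k → a (suc k)) (λ k → v (suc k))

-- A Euclidean structure on ℚ^ℓ given by a symmetric positive definite Gram matrix G:
-- (u , v) = Σ_{i,j} u_i G_ij v_j
Gram : ℕ → Set
Gram ℓ = Fin ℓ → Fin ℓ → ℚ

inner : ∀ {ℓ} → Gram ℓ → Vect ℓ → Vect ℓ → ℚ
inner G u v = sumFin (λ i → sumFin (λ j → lookup u i * (G i j * lookup v j)))

record InnerProduct (ℓ : ℕ) : Set where
  field
    G         : Gram ℓ
    symmetric : ∀ i j → G i j ≡ G j i
    posdef    : ∀ (v : Vect ℓ) → v ≢ zeroV → 0ℚ ℚ.< inner G v v

record RootSystem (ℓ : ℕ) : Set where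
  field
    ip       : InnerProduct ℓ
  _·_ : Vect ℓ → Vect ℓ → ℚ
  _·_ = inner (InnerProduct.G ip)
  field
    Φ        : List (Vect ℓ)
    nonzero : ∀ {α} → α ∈ Φ → α ≢ zeroV
    spans    : ∀ (v : Vect ℓ) →
               ∃ λ (a : Fin (length Φ) → ℚ) → v ≡ lincomb a (List.lookup Φ)
    -- crystallographic: 2(β,α)/(α,α) ∈ ℤ
    cryst    : ∀ {α β} → α ∈ Φ → β ∈ Φ →
               ∃ λ (k : ℤ) → ι (+ 2) * (β · α) ≡ ι k * (α · α)
    -- closed under the reflections s_α β = β - (2(β,α)/(α,α)) α
    reflect  : ∀ {α β} → α ∈ Φ → β ∈ Φ → (k : ℤ) →
               ι (+ 2) * (β · α) ≡ ι k * (α · α) → (β ⊖ scale (ι k) α) ∈ Φ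
    reduced  : ∀ {α} → α ∈ Φ → (c : ℚ) → scale c α ∈ Φ → (c ≡ 1ℚ) ⊎ (c ≡ - 1ℚ)

  Irreducible : Set
  Irreducible =
    ¬ (Σ (Vect ℓ → Bool) λ side →
         (∃ λ α → α ∈ Φ × side α ≡ true) ×
         (∃ λ β → β ∈ Φ × side β ≡ false) ×
         (∀ {α β} → α ∈ Φ → β ∈ Φ → side α ≡ true → side β ≡ false → α · β ≡ 0ℚ))

  -- Δ = (α₁,…,α_ℓ) is a base (set of simple roots): each α_i ∈ Φ and every root is an
  -- integral combination of the α_i with all coefficients ≥ 0 or all ≤ 0.
  -- (This determines the positive system Φ⁺ = roots with nonnegative coefficients.)
  IsBase : (Fin ℓ → Vect ℓ) → Set
  IsBase Δ =
    (∀ i → Δ i ∈ Φ) ×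
    (∀ {β} → β ∈ Φ → ∃ λ (k : Fin ℓ → ℤ) →
       β ≡ lincomb (λ j → ι (k j)) Δ ×
       ((∀ j → + 0 ℤ.≤ k j) ⊎ (∀ j → k j ℤ.≤ + 0)))

  IsHighestRoot : (Fin ℓ → Vect ℓ) → Vect ℓ → (Fin ℓ → ℤ) → Set
  IsHighestRoot Δ α̃ c =
    α̃ ∈ Φ × α̃ ≡ lincomb (λ j → ι (c j)) Δ ×
    (∀ {β} → β ∈ Φ → (k : Fin ℓ → ℤ) → β ≡ lincomb (λ j → ι (k j)) Δ → ∀ j → k j ℤ.≤ c j)

  InCoweight : (Fin ℓ → Vect ℓ) → Vect ℓ → Set
  InCoweight Δ x = ∀ j → ∃ λ (z : ℤ) → Δ j · x ≡ ι z

  InScaledAlcove : (Fin ℓ → Vect ℓ) → Vect ℓ → ℤ → Vect ℓ → Set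
  InScaledAlcove Δ α̃ q x = (∀ j → 0ℚ ℚ.≤ Δ j · x) × (α̃ · x) ℚ.≤ ι q

  -- facets of q Ā (as hyperplane conditions, for points already in q Ā):
  -- index zero is F₀ ⊂ H_{α̃,q}, index (suc j) is F_{j+1} ⊂ H_{α_{j+1},0}
  OnFacet : (Fin ℓ → Vect ℓ) → Vect ℓ → ℤ → Fin (suc ℓ) → Vect ℓ → Set
  OnFacet Δ α̃ q zero    x = α̃ · x ≡ ι q
  OnFacet Δ α̃ q (suc j) x = Δ j · x ≡ 0ℚ

extCoeff : ∀ {ℓ} → (Fin ℓ → ℤ) → Fin (suc ℓ) → ℤ
extCoeff c zero    = + 1
extCoeff c (suc j) = c j

Enumerates : ∀ {A : Set} → (A → Set) → List A → Set
Enumerates {A} P xs = Unique xs × (∀ (x : A) → (x ∈ xs → P x) × (P x → x ∈ xs))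

module Submission where

-- The simple roots give coordinates x ↦ ((α_k , x))_k on V; they are injective
-- because only 0 is orthogonal to every α_k (the inner product is positive definite
-- and the roots span V), and hence, V being finite dimensional, also surjective.
-- In these coordinates Z(Φ) ∩ q Ā becomes the weighted simplex
-- { n ∈ ℕ^ℓ | Σ_k c_k n_k ≤ q }, whose far facet Σ_k c_k n_k = q is F₀ and whose
-- wall n_j = 0 is F_j.  In ℕ^ℓ the count is elementary: the points off the far
-- facet form the simplex of size q - 1, and n ↦ n + e_j maps the simplex of size
-- q - c_j bijectively onto the points off the wall n_j = 0.

open import Defs
open import Data.Nat as ℕ using (ℕ; zero; suc; z≤n; s≤s)
import Data.Nat.Properties as ℕP
open import Data.Integer as ℤ using (ℤ; +_; +≤+; 0ℤ; 1ℤ)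
import Data.Integer.Properties as ℤP
open import Data.Rational as ℚ using (ℚ; mkℚ; 0ℚ; 1ℚ; *≤*)
import Data.Rational.Properties as ℚP
open import Data.Fin using (Fin; zero; suc; punchIn; punchOut)
open import Data.Fin.Properties using (all?; ¬∀⟶∃¬; punchIn-punchOut)
import Data.Fin.Properties as FinP
open import Data.Vec using (Vec; []; _∷_; lookup; tabulate; updateAt)
import Data.Vec.Properties as VecP
open import Data.Vec.Functional as Vector using (Vector; tail)
open import Data.List using (List; []; _∷_; length; map; filter; deduplicate; cartesianProductWith; upTo)
open import Data.List.Properties using (length-map)
import Data.List as List
open import Data.List.Membership.Propositional using (_∈_)
open import Data.List.Membership.Propositional.Properties
  using (∈-map⁺; ∈-map⁻; ∈-filter⁺; ∈-filter⁻; ∈-deduplicate⁺; ∈-cartesianProductWith⁺;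
         ∈-upTo⁺; ∈-lookup)
open import Data.List.Relation.Unary.Any using (here)
import Data.List.Relation.Unary.Unique.Propositional.Properties as Unique
open import Data.List.Relation.Unary.Unique.DecPropositional.Properties using (deduplicate-!)
open import Algebra.Bundles using (CommutativeRing)
open import Algebra.Properties.Semiring.Sum (CommutativeRing.semiring ℚP.+-*-commutativeRing)
  using (sum; sum-cong-≗; ∑-comm; ∑-distrib-+; *-distribˡ-sum; *-distribʳ-sum)
import Data.Nat.Coprimality as Coprimality
open import Data.Product using (∃; _×_; _,_; proj₁; proj₂)
open import Data.Empty using (⊥-elim)
open import Function using (_∘_; _⇔_; mk⇔; Equivalence; Injective)
open import Relation.Binary.Definitions using (DecidableEquality)
open import Relation.Binary.PropositionalEquality
open import Relation.Nullary using (¬_; yes; no)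
open import Relation.Unary using (Decidable)

module Enumeration where

  enumerates-map : ∀ {A B : Set} {P : A → Set} {Q : B → Set} {ys : List B} (f : B → A) →
    Injective _≡_ _≡_ f → Enumerates Q ys →
    (∀ y → Q y → P (f y)) → (∀ x → P x → ∃ λ y → Q y × x ≡ f y) →
    Enumerates P (map f ys)
  enumerates-map {P = P} {ys = ys} f f-injective (unique , complete) image⊆P P⊆image =
    Unique.map⁺ f-injective unique , λ x → listed⇒P x , P⇒listed x
    where
    listed⇒P : ∀ x → x ∈ map f ys → P x
    listed⇒P x x∈ with ∈-map⁻ f x∈
    ... | y , y∈ , refl = image⊆P y (proj₁ (complete y) y∈)
    P⇒listed : ∀ x → P x → x ∈ map f ys
    P⇒listed x px with P⊆image x px
    ... | y , qy , refl = ∈-map⁺ f (proj₂ (complete y) qy)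

  enumerates-filter : ∀ {A : Set} {P : A → Set} (_≟_ : DecidableEquality A) (P? : Decidable P)
    (xs : List A) → (∀ x → P x → x ∈ xs) → Enumerates P (filter P? (deduplicate _≟_ xs))
  enumerates-filter _≟_ P? xs covers =
    Unique.filter⁺ P? (deduplicate-! _≟_ xs) ,
    λ x → (λ x∈ → proj₂ (∈-filter⁻ P? {xs = deduplicate _≟_ xs} x∈)) ,
          (λ px → ∈-filter⁺ P? (∈-deduplicate⁺ _≟_ (covers x px)) px)

module WeightedSimplex where
  open Enumeration
  open import Data.Integer.Solver using (module +-*-Solver)
  open +-*-Solver

  weight : ∀ {ℓ} → (Fin ℓ → ℤ) → Vec ℕ ℓ → ℤ
  weight w []      = 0ℤ
  weight w (a ∷ n) = w zero ℤ.* + a ℤ.+ weight (w ∘ suc) n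

  InSimplex : ∀ {ℓ} → (Fin ℓ → ℤ) → ℤ → Vec ℕ ℓ → Set
  InSimplex w q n = weight w n ℤ.≤ q

  OnSimplexFacet : ∀ {ℓ} → (Fin ℓ → ℤ) → ℤ → Fin (suc ℓ) → Vec ℕ ℓ → Set
  OnSimplexFacet w q zero    n = weight w n ≡ q
  OnSimplexFacet w q (suc j) n = lookup n j ≡ 0

  -- With positive weights every term w_k n_k, hence the weight, is nonnegative, and
  -- each coordinate n_k is bounded by the weight; this makes the simplex finite.
  term-nonneg : ∀ {c} → 1ℤ ℤ.≤ c → ∀ a → 0ℤ ℤ.≤ c ℤ.* + a
  term-nonneg c≥1 a = ℤP.*-monoʳ-≤-nonNeg (+ a) (ℤP.≤-trans (+≤+ z≤n) c≥1)

  weight-nonneg : ∀ {ℓ} {w : Fin ℓ → ℤ} → (∀ k → 1ℤ ℤ.≤ w k) → ∀ n → 0ℤ ℤ.≤ weight w n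
  weight-nonneg w≥1 []      = ℤP.≤-refl
  weight-nonneg w≥1 (a ∷ n) = ℤP.+-mono-≤ (term-nonneg (w≥1 zero) a) (weight-nonneg (w≥1 ∘ suc) n)

  coordinate-≤-weight : ∀ {ℓ} {w : Fin ℓ → ℤ} → (∀ k → 1ℤ ℤ.≤ w k) →
    ∀ n k → + lookup n k ℤ.≤ weight w n
  coordinate-≤-weight {w = w} w≥1 (a ∷ n) zero = begin
    + a                                   ≡⟨ sym (ℤP.*-identityˡ (+ a)) ⟩
    1ℤ ℤ.* + a                            ≤⟨ ℤP.*-monoʳ-≤-nonNeg (+ a) (w≥1 zero) ⟩
    w zero ℤ.* + a                        ≤⟨ ℤP.i≤i+j _ _ {{ℤ.nonNegative (weight-nonneg (w≥1 ∘ suc) n)}} ⟩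
    w zero ℤ.* + a ℤ.+ weight (w ∘ suc) n ∎
    where open ℤP.≤-Reasoning
  coordinate-≤-weight {w = w} w≥1 (a ∷ n) (suc k) = begin
    + lookup n k                          ≤⟨ coordinate-≤-weight (w≥1 ∘ suc) n k ⟩
    weight (w ∘ suc) n                    ≤⟨ ℤP.i≤j+i _ _ {{ℤ.nonNegative (term-nonneg (w≥1 zero) a)}} ⟩
    w zero ℤ.* + a ℤ.+ weight (w ∘ suc) n ∎
    where open ℤP.≤-Reasoning

  box : ∀ ℓ → ℕ → List (Vec ℕ ℓ)
  box zero    B = [] ∷ []
  box (suc ℓ) B = cartesianProductWith _∷_ (upTo (suc B)) (box ℓ B)

  ∈-box : ∀ {ℓ B} (n : Vec ℕ ℓ) → (∀ k → lookup n k ℕ.≤ B) → n ∈ box ℓ B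
  ∈-box []      bounded = here refl
  ∈-box (a ∷ n) bounded =
    ∈-cartesianProductWith⁺ _∷_ (∈-upTo⁺ (s≤s (bounded zero))) (∈-box n (bounded ∘ suc))

  simplexPoints : ∀ {ℓ} → (Fin ℓ → ℤ) → ℤ → List (Vec ℕ ℓ)
  simplexPoints {ℓ} w q =
    filter (λ n → weight w n ℤP.≤? q) (deduplicate (VecP.≡-dec ℕP._≟_) (box ℓ ℤ.∣ q ∣))

  -- With positive weights the simplex of size q lies in the box of side |q|.
  simplex-enumerated : ∀ {ℓ} {w : Fin ℓ → ℤ} → (∀ k → 1ℤ ℤ.≤ w k) →
    ∀ q → Enumerates (InSimplex w q) (simplexPoints w q)
  simplex-enumerated w≥1 q = enumerates-filter _ _ _ λ n n∈ →
    ∈-box n (λ k → below-abs (ℤP.≤-trans (coordinate-≤-weight w≥1 n k) n∈))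
    where
    below-abs : ∀ {s q} → + s ℤ.≤ q → s ℕ.≤ ℤ.∣ q ∣
    below-abs (+≤+ s≤q) = s≤q

  shift : ∀ {ℓ} → Fin (suc ℓ) → Vec ℕ ℓ → Vec ℕ ℓ
  shift zero    n = n
  shift (suc j) n = updateAt n j suc

  shift-injective : ∀ {ℓ} (i : Fin (suc ℓ)) → Injective _≡_ _≡_ (shift {ℓ} i)
  shift-injective zero    eq = eq
  shift-injective (suc j) {m} {m′} eq = begin
    m                                     ≡⟨ sym (unshift-shift m) ⟩
    updateAt (updateAt m j suc) j ℕ.pred  ≡⟨ cong (λ n → updateAt n j ℕ.pred) eq ⟩
    updateAt (updateAt m′ j suc) j ℕ.pred ≡⟨ unshift-shift m′ ⟩
    m′                                    ∎
    where
    open ≡-Reasoning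
    unshift-shift : ∀ n → updateAt (updateAt n j suc) j ℕ.pred ≡ n
    unshift-shift n = trans (VecP.updateAt-updateAt-local j n refl) (VecP.updateAt-id j n)

  weight-shift : ∀ {ℓ} (w : Fin ℓ → ℤ) j (n : Vec ℕ ℓ) →
    weight w (updateAt n j suc) ≡ w j ℤ.+ weight w n
  weight-shift w zero    (a ∷ n) =
    solve 3 (λ c a W → c :* (con 1ℤ :+ a) :+ W := c :+ (c :* a :+ W)) refl (w zero) (+ a) (weight (w ∘ suc) n)
  weight-shift w (suc j) (a ∷ n) = trans (cong (λ W → w zero ℤ.* + a ℤ.+ W) (weight-shift (w ∘ suc) j n))
    (solve 3 (λ t c W → t :+ (c :+ W) := c :+ (t :+ W)) refl (w zero ℤ.* + a) (w (suc j)) (weight (w ∘ suc) n))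

  ≤-minus⁺ : ∀ {a b q} → b ℤ.+ a ℤ.≤ q → a ℤ.≤ q ℤ.- b
  ≤-minus⁺ {a} {b} {q} b+a≤q = subst (ℤ._≤ q ℤ.- b)
    (solve 2 (λ a b → (b :+ a) :- b := a) refl a b) (ℤP.+-monoˡ-≤ (ℤ.- b) b+a≤q)

  ≤-minus⁻ : ∀ {a b q} → a ℤ.≤ q ℤ.- b → b ℤ.+ a ℤ.≤ q
  ≤-minus⁻ {a} {b} {q} a≤q-b = subst (b ℤ.+ a ℤ.≤_)
    (solve 2 (λ q b → b :+ (q :- b) := q) refl q b) (ℤP.+-monoʳ-≤ b a≤q-b)

  -- The points off facet i are exactly the translates by shift i of the simplex of
  -- size q - w_i, where w_0 = 1 for the far facet.
  module _ {ℓ} (w : Fin ℓ → ℤ) (q : ℤ) where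

    shift-into : ∀ i m → InSimplex w (q ℤ.- extCoeff w i) m →
      InSimplex w q (shift i m) × ¬ OnSimplexFacet w q i (shift i m)
    shift-into zero    m m∈ = ℤP.<⇒≤ weight<q , ℤP.<⇒≢ weight<q
      where
      weight<q : weight w m ℤ.< q
      weight<q = ℤP.suc[i]≤j⇒i<j (≤-minus⁻ m∈)
    shift-into (suc j) m m∈ =
      subst (ℤ._≤ q) (sym (weight-shift w j m)) (≤-minus⁻ m∈) ,
      λ on-wall → ℕP.1+n≢0 (trans (sym (VecP.lookup∘updateAt j m)) on-wall)

    shift-onto : ∀ i n → InSimplex w q n × ¬ OnSimplexFacet w q i n →
      ∃ λ m → InSimplex w (q ℤ.- extCoeff w i) m × n ≡ shift i m
    shift-onto zero    n (n∈ , off) = n , ≤-minus⁺ (ℤP.i<j⇒suc[i]≤j (ℤP.≤∧≢⇒< n∈ off)) , refl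
    shift-onto (suc j) n (n∈ , off) =
      m , ≤-minus⁺ (subst (ℤ._≤ q) (weight-shift w j m) weight≤q) , sym shifted
      where
      m : Vec ℕ ℓ
      m = updateAt n j ℕ.pred
      shifted : updateAt m j suc ≡ n
      shifted = trans (VecP.updateAt-updateAt-local j n (ℕP.suc-pred _ {{ℕ.≢-nonZero off}}))
                      (VecP.updateAt-id j n)
      weight≤q : weight w (updateAt m j suc) ℤ.≤ q
      weight≤q = subst (λ n → weight w n ℤ.≤ q) (sym shifted) n∈

  off-facet-enumerated : ∀ {ℓ} {w : Fin ℓ → ℤ} → (∀ k → 1ℤ ℤ.≤ w k) → ∀ i q →
    Enumerates (λ n → InSimplex w q n × ¬ OnSimplexFacet w q i n)
               (map (shift i) (simplexPoints w (q ℤ.- extCoeff w i)))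
  off-facet-enumerated {w = w} w≥1 i q =
    enumerates-map (shift i) (shift-injective i) (simplex-enumerated w≥1 _)
                   (shift-into w q i) (shift-onto w q i)

module LinearAlgebra where
  open import Data.Rational using (_+_; _*_; _-_; 1/_; NonZero; ≢-nonZero)
  open import Data.Rational.Solver using (module +-*-Solver)
  open +-*-Solver

  sumFin≡sum : ∀ {n} (f : Fin n → ℚ) → sumFin f ≡ sum f
  sumFin≡sum {zero}  f = refl
  sumFin≡sum {suc n} f = cong (λ S → f zero + S) (sumFin≡sum (f ∘ suc))

  sum-sub : ∀ {n} (f g : Vector ℚ n) → sum (λ k → f k - g k) ≡ sum f - sum g
  sum-sub {zero}  f g = refl
  sum-sub {suc n} f g = trans (cong (λ S → f zero - g zero + S) (sum-sub (tail f) (tail g)))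
    (solve 4 (λ a b A B → (a :- b) :+ (A :- B) := (a :+ A) :- (b :+ B)) refl
       (f zero) (g zero) (sum (tail f)) (sum (tail g)))

  sum-scale : ∀ {n} (c : ℚ) (f : Vector ℚ n) → sum (λ k → c * f k) ≡ c * sum f
  sum-scale {zero}  c f = solve 1 (λ c → con 0ℚ := c :* con 0ℚ) refl c
  sum-scale {suc n} c f = trans (cong (λ S → c * f zero + S) (sum-scale c (tail f)))
    (solve 3 (λ c a A → c :* a :+ c :* A := c :* (a :+ A)) refl c (f zero) (sum (tail f)))

  dot : ∀ {n} → Vector ℚ n → Vector ℚ n → ℚ
  dot f g = sum (λ k → f k * g k)

  dot-congʳ : ∀ {n} (f : Vector ℚ n) {g h : Vector ℚ n} → (∀ k → g k ≡ h k) → dot f g ≡ dot f h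
  dot-congʳ {n} f g≗h = sum-cong-≗ {n} (λ k → cong (f k *_) (g≗h k))

  dot-congˡ : ∀ {n} {f g : Vector ℚ n} → (∀ k → f k ≡ g k) → ∀ h → dot f h ≡ dot g h
  dot-congˡ {n} f≗g h = sum-cong-≗ {n} (λ k → cong (_* h k) (f≗g k))

  dot-zeroʳ : ∀ {n} (f : Vector ℚ n) → dot f (λ _ → 0ℚ) ≡ 0ℚ
  dot-zeroʳ {n} f = trans (sum-cong-≗ {n} (λ k → ℚP.*-comm (f k) 0ℚ))
                          (trans (sum-scale 0ℚ f) (ℚP.*-zeroˡ (sum f)))

  dot-subʳ : ∀ {n} (f g h : Vector ℚ n) → dot f (λ k → g k - h k) ≡ dot f g - dot f h
  dot-subʳ f g h =
    trans (sum-cong-≗ (λ k → solve 3 (λ a b c → a :* (b :- c) := a :* b :- a :* c) refl (f k) (g k) (h k)))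
          (sum-sub (λ k → f k * g k) (λ k → f k * h k))

  dot-addˡ : ∀ {n} (c : ℚ) (f g h : Vector ℚ n) → dot (λ k → c * f k + g k) h ≡ c * dot f h + dot g h
  dot-addˡ c f g h = begin
    dot (λ k → c * f k + g k) h
      ≡⟨ sum-cong-≗ (λ k → solve 4 (λ c a b x → (c :* a :+ b) :* x := c :* (a :* x) :+ b :* x)
                                   refl c (f k) (g k) (h k)) ⟩
    sum (λ k → c * (f k * h k) + g k * h k)
      ≡⟨ ∑-distrib-+ (λ k → c * (f k * h k)) (λ k → g k * h k) ⟩
    sum (λ k → c * (f k * h k)) + dot g h
      ≡⟨ cong (_+ dot g h) (sum-scale c (λ k → f k * h k)) ⟩
    c * dot f h + dot g h ∎
    where open ≡-Reasoning

  dot-subˡ : ∀ {n} (f g h : Vector ℚ n) (c : ℚ) → dot (λ k → f k - c * g k) h ≡ dot f h - c * dot g h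
  dot-subˡ f g h c = begin
    dot (λ k → f k - c * g k) h
      ≡⟨ sum-cong-≗ (λ k → solve 4 (λ a b c x → (a :- c :* b) :* x := a :* x :- c :* (b :* x))
                                   refl (f k) (g k) c (h k)) ⟩
    sum (λ k → f k * h k - c * (g k * h k))
      ≡⟨ sum-sub (λ k → f k * h k) (λ k → c * (g k * h k)) ⟩
    dot f h - sum (λ k → c * (g k * h k))
      ≡⟨ cong (λ s → dot f h - s) (sum-scale c (λ k → g k * h k)) ⟩
    dot f h - c * dot g h ∎
    where open ≡-Reasoning

  TrivialKernel : ∀ {n} → (Fin n → Vector ℚ n) → Set
  TrivialKernel M = ∀ x → (∀ j → dot (M j) x ≡ 0ℚ) → ∀ k → x k ≡ 0ℚ

  kernel-injective : ∀ {n} (M : Fin n → Vector ℚ n) → TrivialKernel M →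
    ∀ x y → (∀ j → dot (M j) x ≡ dot (M j) y) → ∀ k → x k ≡ y k
  kernel-injective M ker x y Mx≡My k =
    trans (solve 2 (λ x y → x := (x :- y) :+ y) refl (x k) (y k))
   (trans (cong (_+ y k) (ker (λ k → x k - y k) Mx-y≡0 k))
          (solve 1 (λ y → con 0ℚ :+ y := y) refl (y k)))
    where
    Mx-y≡0 : ∀ j → dot (M j) (λ k → x k - y k) ≡ 0ℚ
    Mx-y≡0 j = trans (dot-subʳ (M j) x y)
      (trans (cong (_- dot (M j) y) (Mx≡My j)) (solve 1 (λ a → a :- a := con 0ℚ) refl (dot (M j) y)))

  pivot-or-other : ∀ {n} (p : Fin (suc n)) (P : Fin (suc n) → Set) →
    P p → (∀ j′ → P (punchIn p j′)) → ∀ j → P j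
  pivot-or-other p P at-p elsewhere j with p FinP.≟ j
  ... | yes refl = at-p
  ... | no p≢j   = subst P (punchIn-punchOut p≢j) (elsewhere (punchOut p≢j))

  -- One step of Gaussian elimination with pivot M p 0 ≠ 0: subtracting
  -- ratio j = M j 0 / M p 0 times the pivot row clears the first column.
  module Elimination {n} (M : Fin (suc n) → Vector ℚ (suc n)) (p : Fin (suc n))
                     (pivot≢0 : M p zero ≢ 0ℚ) where
    instance
      pivot-nonZero : NonZero (M p zero)
      pivot-nonZero = ≢-nonZero pivot≢0

    ratio : Fin (suc n) → ℚ
    ratio j = M j zero * 1/ (M p zero)

    cleared : Fin (suc n) → Vector ℚ n
    cleared j k = tail (M j) k - ratio j * tail (M p) k

    reduced : Fin n → Vector ℚ n
    reduced j′ = cleared (punchIn p j′)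

    row-split : ∀ j x₀ y →
      dot (M j) (x₀ Vector.∷ y) ≡ ratio j * dot (M p) (x₀ Vector.∷ y) + dot (cleared j) y
    row-split j x₀ y = sym (begin
      ratio j * (a * x₀ + Dp) + dot (cleared j) y
        ≡⟨ cong (λ S → ratio j * (a * x₀ + Dp) + S) (dot-subˡ (tail (M j)) (tail (M p)) y (ratio j)) ⟩
      ratio j * (a * x₀ + Dp) + (Dj - ratio j * Dp)
        ≡⟨ solve 6 (λ m ia a x₀ Dp Dj → m :* ia :* (a :* x₀ :+ Dp) :+ (Dj :- m :* ia :* Dp)
                                     := m :* (a :* ia) :* x₀ :+ Dj)
             refl (M j zero) (1/ a) a x₀ Dp Dj ⟩
      M j zero * (a * 1/ a) * x₀ + Dj
        ≡⟨ cong (λ t → M j zero * t * x₀ + Dj) (ℚP.*-inverseʳ a) ⟩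
      M j zero * 1ℚ * x₀ + Dj
        ≡⟨ solve 3 (λ m x₀ Dj → m :* con 1ℚ :* x₀ :+ Dj := m :* x₀ :+ Dj) refl (M j zero) x₀ Dj ⟩
      M j zero * x₀ + Dj ∎)
      where
      open ≡-Reasoning
      a Dp Dj : ℚ
      a = M p zero
      Dp = dot (tail (M p)) y
      Dj = dot (tail (M j)) y

    pivot-solve : ℚ → Vector ℚ n → ℚ
    pivot-solve t y = (t - dot (tail (M p)) y) * 1/ (M p zero)

    pivot-row : ∀ t y → dot (M p) (pivot-solve t y Vector.∷ y) ≡ t
    pivot-row t y =
      trans (solve 4 (λ a ia t D → a :* ((t :- D) :* ia) :+ D := (a :* ia) :* (t :- D) :+ D) refl a (1/ a) t D)
     (trans (cong (λ s → s * (t - D) + D) (ℚP.*-inverseʳ a))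
            (solve 2 (λ t D → con 1ℚ :* (t :- D) :+ D := t) refl t D))
      where
      a D : ℚ
      a = M p zero
      D = dot (tail (M p)) y

    reduced-kernel : TrivialKernel M → TrivialKernel reduced
    reduced-kernel ker y reduced-y≡0 k = ker (pivot-solve 0ℚ y Vector.∷ y) rows (suc k)
      where
      rows : ∀ j → dot (M j) (pivot-solve 0ℚ y Vector.∷ y) ≡ 0ℚ
      rows = pivot-or-other p _ (pivot-row 0ℚ y) λ j′ →
        trans (row-split (punchIn p j′) _ y)
       (trans (cong₂ (λ s t → ratio (punchIn p j′) * s + t) (pivot-row 0ℚ y) (reduced-y≡0 j′))
              (solve 1 (λ r → r :* con 0ℚ :+ con 0ℚ := con 0ℚ) refl (ratio (punchIn p j′))))

    extend-solution : (b : Vector ℚ (suc n)) (y : Vector ℚ n) →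
      (∀ j′ → dot (reduced j′) y ≡ b (punchIn p j′) - ratio (punchIn p j′) * b p) →
      ∀ j → dot (M j) (pivot-solve (b p) y Vector.∷ y) ≡ b j
    extend-solution b y reduced-y≡b′ = pivot-or-other p _ (pivot-row (b p) y) λ j′ →
      trans (row-split (punchIn p j′) _ y)
     (trans (cong₂ (λ s t → ratio (punchIn p j′) * s + t) (pivot-row (b p) y) (reduced-y≡b′ j′))
            (solve 3 (λ r bp bj → r :* bp :+ (bj :- r :* bp) := bj) refl
                     (ratio (punchIn p j′)) (b p) (b (punchIn p j′))))

  -- A square system with trivial kernel is solvable, by Gaussian elimination:
  -- the first column has a nonzero pivot (otherwise e₀ lies in the kernel), and
  -- the reduced system again has trivial kernel.
  solve-system : ∀ {n} (M : Fin n → Vector ℚ n) → TrivialKernel M →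
    (b : Vector ℚ n) → ∃ λ x → ∀ j → dot (M j) x ≡ b j
  solve-system {zero}  M ker b = (λ ()) , λ ()
  solve-system {suc n} M ker b with all? (λ j → ℚP._≟_ (M j zero) 0ℚ)
  ... | yes first-column≡0 = ⊥-elim (1≢0 (ker e₀ e₀∈kernel zero))
    where
    1≢0 : 1ℚ ≢ 0ℚ
    1≢0 ()
    e₀ : Vector ℚ (suc n)
    e₀ = 1ℚ Vector.∷ (λ _ → 0ℚ)
    e₀∈kernel : ∀ j → dot (M j) e₀ ≡ 0ℚ
    e₀∈kernel j = cong₂ _+_ (trans (ℚP.*-identityʳ (M j zero)) (first-column≡0 j)) (dot-zeroʳ (tail (M j)))
  ... | no first-column≢0 with ¬∀⟶∃¬ _ _ (λ j → ℚP._≟_ (M j zero) 0ℚ) first-column≢0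
  ...   | p , pivot≢0 = pivot-solve (b p) y Vector.∷ y , extend-solution b y y-solves
    where
    open Elimination M p pivot≢0
    reduced-rhs : Vector ℚ n
    reduced-rhs j′ = b (punchIn p j′) - ratio (punchIn p j′) * b p
    reduced-solution : ∃ λ y → ∀ j′ → dot (reduced j′) y ≡ reduced-rhs j′
    reduced-solution = solve-system reduced (reduced-kernel ker) reduced-rhs
    y : Vector ℚ n
    y = proj₁ reduced-solution
    y-solves : ∀ j′ → dot (reduced j′) y ≡ reduced-rhs j′
    y-solves = proj₂ reduced-solution

module IntegersInℚ where
  open import Data.Rational using (_+_; _*_)
  open WeightedSimplex using (weight)

  ι-mkℚ : ∀ z → ι z ≡ mkℚ z 0 (Coprimality.sym (Coprimality.1-coprimeTo ℤ.∣ z ∣))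
  ι-mkℚ z = ℚP.fromℚᵘ-toℚᵘ (mkℚ z 0 (Coprimality.sym (Coprimality.1-coprimeTo ℤ.∣ z ∣)))

  ι-+ : ∀ a b → ι (a ℤ.+ b) ≡ ι a + ι b
  ι-+ a b = sym (begin
    ι a + ι b                           ≡⟨ cong₂ _+_ (ι-mkℚ a) (ι-mkℚ b) ⟩
    ι (a ℤ.* + 1 ℤ.+ b ℤ.* + 1)         ≡⟨ cong ι (cong₂ ℤ._+_ (ℤP.*-identityʳ a) (ℤP.*-identityʳ b)) ⟩
    ι (a ℤ.+ b)                         ∎)
    where open ≡-Reasoning

  ι-* : ∀ a b → ι (a ℤ.* b) ≡ ι a * ι b
  ι-* a b = sym (cong₂ _*_ (ι-mkℚ a) (ι-mkℚ b))

  ι-mono : ∀ {a b} → a ℤ.≤ b → ι a ℚ.≤ ι b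
  ι-mono {a} {b} a≤b rewrite ι-mkℚ a | ι-mkℚ b =
    *≤* (subst₂ ℤ._≤_ (sym (ℤP.*-identityʳ a)) (sym (ℤP.*-identityʳ b)) a≤b)

  ι-cancel-≤ : ∀ {a b} → ι a ℚ.≤ ι b → a ℤ.≤ b
  ι-cancel-≤ {a} {b} ιa≤ιb rewrite ι-mkℚ a | ι-mkℚ b with ιa≤ιb
  ... | *≤* a*1≤b*1 = subst₂ ℤ._≤_ (ℤP.*-identityʳ a) (ℤP.*-identityʳ b) a*1≤b*1

  ι-injective : ∀ {a b} → ι a ≡ ι b → a ≡ b
  ι-injective ιa≡ιb =
    ℤP.≤-antisym (ι-cancel-≤ (ℚP.≤-reflexive ιa≡ιb)) (ι-cancel-≤ (ℚP.≤-reflexive (sym ιa≡ιb)))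

  ι-weight : ∀ {ℓ} (w : Fin ℓ → ℤ) (n : Vec ℕ ℓ) →
    sum (λ k → ι (w k) * ι (+ lookup n k)) ≡ ι (weight w n)
  ι-weight w []      = refl
  ι-weight w (a ∷ n) = begin
    ι (w zero) * ι (+ a) + sum (λ k → ι (w (suc k)) * ι (+ lookup n k))
      ≡⟨ cong₂ _+_ (sym (ι-* (w zero) (+ a))) (ι-weight (w ∘ suc) n) ⟩
    ι (w zero ℤ.* + a) + ι (weight (w ∘ suc) n)
      ≡⟨ sym (ι-+ (w zero ℤ.* + a) (weight (w ∘ suc) n)) ⟩
    ι (weight w (a ∷ n)) ∎
    where open ≡-Reasoning

module Vectors where
  open import Data.Rational using (_+_; _*_)
  open LinearAlgebra using (sum-scale)

  vec-ext : ∀ {A : Set} {ℓ} {u v : Vec A ℓ} → (∀ i → lookup u i ≡ lookup v i) → u ≡ v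
  vec-ext {u = u} {v} u≗v =
    trans (sym (VecP.tabulate∘lookup u)) (trans (VecP.tabulate-cong u≗v) (VecP.tabulate∘lookup v))

  lookup-lincomb : ∀ {n ℓ} (a : Fin n → ℚ) (w : Fin n → Vect ℓ) i →
    lookup (lincomb a w) i ≡ sum (λ k → a k * lookup (w k) i)
  lookup-lincomb {zero}  a w i = VecP.lookup-replicate i 0ℚ
  lookup-lincomb {suc n} a w i =
    trans (VecP.lookup-zipWith _+_ i (scale (a zero) (w zero)) (lincomb (a ∘ suc) (w ∘ suc)))
          (cong₂ _+_ (VecP.lookup-map i (a zero *_) (w zero)) (lookup-lincomb (a ∘ suc) (w ∘ suc) i))

  unit : ∀ {n} → Fin n → Fin n → ℤ
  unit zero    zero    = 1ℤ
  unit zero    (suc _) = 0ℤ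
  unit (suc _) zero    = 0ℤ
  unit (suc j) (suc k) = unit j k

  unit-diagonal : ∀ {n} (k : Fin n) → unit k k ≡ 1ℤ
  unit-diagonal zero    = refl
  unit-diagonal (suc k) = unit-diagonal k

  sum-unit : ∀ {n} (k : Fin n) (f : Vector ℚ n) → sum (λ j → ι (unit k j) * f j) ≡ f k
  sum-unit zero    f = trans (cong₂ _+_ (ℚP.*-identityˡ (f zero))
                                        (trans (sum-scale 0ℚ (f ∘ suc)) (ℚP.*-zeroˡ (sum (f ∘ suc)))))
                             (ℚP.+-identityʳ (f zero))
  sum-unit (suc k) f =
    trans (cong₂ _+_ (ℚP.*-zeroˡ (f zero)) (sum-unit k (f ∘ suc))) (ℚP.+-identityˡ (f (suc k)))

  unit-lincomb : ∀ {n ℓ} (w : Fin n → Vect ℓ) k → lincomb (λ j → ι (unit k j)) w ≡ w k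
  unit-lincomb w k = vec-ext λ i →
    trans (lookup-lincomb (λ j → ι (unit k j)) w i) (sum-unit k (λ j → lookup (w j) i))

module Coordinates {ℓ} (R : RootSystem ℓ) (Δ : Fin ℓ → Vect ℓ) (base : RootSystem.IsBase R Δ) where
  open import Data.Rational using (_+_; _*_)
  open RootSystem R
  open InnerProduct ip
  open LinearAlgebra
  open Vectors using (vec-ext)

  Gv : Vect ℓ → Vector ℚ ℓ
  Gv v i = sum (λ j → G i j * lookup v j)

  uG : Vect ℓ → Vector ℚ ℓ
  uG u j = sum (λ i → lookup u i * G i j)

  inner-sum : ∀ u v → u · v ≡ sum (λ i → sum (λ j → lookup u i * (G i j * lookup v j)))
  inner-sum u v = trans (sumFin≡sum (λ i → sumFin (term i))) (sum-cong-≗ {ℓ} (λ i → sumFin≡sum (term i)))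
    where
    term : Fin ℓ → Fin ℓ → ℚ
    term i j = lookup u i * (G i j * lookup v j)

  inner-as-dotˡ : ∀ u v → u · v ≡ dot (lookup u) (Gv v)
  inner-as-dotˡ u v = trans (inner-sum u v)
    (sum-cong-≗ {ℓ} (λ i → sym (*-distribˡ-sum (lookup u i) (λ j → G i j * lookup v j))))

  inner-as-dotʳ : ∀ u v → u · v ≡ dot (uG u) (lookup v)
  inner-as-dotʳ u v = begin
    u · v
      ≡⟨ inner-sum u v ⟩
    sum (λ i → sum (λ j → lookup u i * (G i j * lookup v j)))
      ≡⟨ ∑-comm {ℓ} {ℓ} _ ⟩
    sum (λ j → sum (λ i → lookup u i * (G i j * lookup v j)))
      ≡⟨ sum-cong-≗ {ℓ} (λ j → sum-cong-≗ {ℓ} (λ i → sym (ℚP.*-assoc (lookup u i) (G i j) (lookup v j)))) ⟩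
    sum (λ j → sum (λ i → lookup u i * G i j * lookup v j))
      ≡⟨ sum-cong-≗ {ℓ} (λ j → sym (*-distribʳ-sum (lookup v j) (λ i → lookup u i * G i j))) ⟩
    dot (uG u) (lookup v) ∎
    where open ≡-Reasoning

  inner-lincomb : ∀ {n} (a : Fin n → ℚ) (w : Fin n → Vect ℓ) v →
    lincomb a w · v ≡ sum (λ k → a k * (w k · v))
  inner-lincomb {zero} a w v = begin
    zeroV · v                         ≡⟨ inner-as-dotˡ zeroV v ⟩
    dot (lookup zeroV) (Gv v)         ≡⟨ dot-congˡ (λ i → VecP.lookup-replicate i 0ℚ) (Gv v) ⟩
    sum (λ i → 0ℚ * Gv v i)           ≡⟨ sum-scale 0ℚ (Gv v) ⟩
    0ℚ * sum (Gv v)                   ≡⟨ ℚP.*-zeroˡ (sum (Gv v)) ⟩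
    0ℚ                                ∎
    where open ≡-Reasoning
  inner-lincomb {suc n} a w v = begin
    (scale a₀ w₀ ⊕ rest) · v
      ≡⟨ inner-as-dotˡ (scale a₀ w₀ ⊕ rest) v ⟩
    dot (lookup (scale a₀ w₀ ⊕ rest)) (Gv v)
      ≡⟨ dot-congˡ (λ i → trans (VecP.lookup-zipWith _+_ i (scale a₀ w₀) rest)
                                (cong (_+ lookup rest i) (VecP.lookup-map i (a₀ *_) w₀))) (Gv v) ⟩
    dot (λ i → a₀ * lookup w₀ i + lookup rest i) (Gv v)
      ≡⟨ dot-addˡ a₀ (lookup w₀) (lookup rest) (Gv v) ⟩
    a₀ * dot (lookup w₀) (Gv v) + dot (lookup rest) (Gv v)
      ≡⟨ sym (cong₂ (λ s t → a₀ * s + t) (inner-as-dotˡ w₀ v) (inner-as-dotˡ rest v)) ⟩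
    a₀ * (w₀ · v) + rest · v
      ≡⟨ cong (λ t → a₀ * (w₀ · v) + t) (inner-lincomb (a ∘ suc) (w ∘ suc) v) ⟩
    sum (λ k → a k * (w k · v)) ∎
    where
    open ≡-Reasoning
    a₀ : ℚ
    a₀ = a zero
    w₀ : Vect ℓ
    w₀ = w zero
    rest : Vect ℓ
    rest = lincomb (a ∘ suc) (w ∘ suc)

  lincomb-orthogonal : ∀ {n} (a : Fin n → ℚ) (w : Fin n → Vect ℓ) x →
    (∀ k → w k · x ≡ 0ℚ) → lincomb a w · x ≡ 0ℚ
  lincomb-orthogonal a w x w⊥x =
    trans (inner-lincomb a w x) (trans (dot-congʳ a w⊥x) (dot-zeroʳ a))

  -- The simple roots detect vectors: only 0 is orthogonal to all of them, since
  -- such a vector is orthogonal to every root, hence to all of V = span Φ,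
  -- in particular to itself.
  orthogonal-to-base⇒zero : ∀ x → (∀ j → Δ j · x ≡ 0ℚ) → x ≡ zeroV
  orthogonal-to-base⇒zero x x⊥Δ with VecP.≡-dec ℚP._≟_ x zeroV
  ... | yes x≡0 = x≡0
  ... | no  x≢0 = ⊥-elim (ℚP.<-irrefl (sym (everything⊥x x)) (posdef x x≢0))
    where
    root⊥x : ∀ {β} → β ∈ Φ → β · x ≡ 0ℚ
    root⊥x β∈Φ with proj₂ base β∈Φ
    ... | k , refl , _ = lincomb-orthogonal (λ j → ι (k j)) Δ x x⊥Δ
    everything⊥x : ∀ v → v · x ≡ 0ℚ
    everything⊥x v with spans v
    ... | a , refl = lincomb-orthogonal a (List.lookup Φ) x (λ m → root⊥x (∈-lookup m))

  -- The coordinate map x ↦ ((α_j , x))_j as a matrix acting on the entries of x.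
  coordinateMatrix : Fin ℓ → Vector ℚ ℓ
  coordinateMatrix j = uG (Δ j)

  coordinate-matrix-kernel : TrivialKernel coordinateMatrix
  coordinate-matrix-kernel y Δy≡0 k = begin
    y k                     ≡⟨ sym (VecP.lookup∘tabulate y k) ⟩
    lookup (tabulate y) k   ≡⟨ cong (λ v → lookup v k) (orthogonal-to-base⇒zero (tabulate y) Δ⊥y) ⟩
    lookup zeroV k          ≡⟨ VecP.lookup-replicate k 0ℚ ⟩
    0ℚ                      ∎
    where
    open ≡-Reasoning
    Δ⊥y : ∀ j → Δ j · tabulate y ≡ 0ℚ
    Δ⊥y j = trans (inner-as-dotʳ (Δ j) (tabulate y))
                  (trans (dot-congʳ (uG (Δ j)) (VecP.lookup∘tabulate y)) (Δy≡0 j))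

  coordinates-injective : ∀ x y → (∀ j → Δ j · x ≡ Δ j · y) → x ≡ y
  coordinates-injective x y same =
    vec-ext (kernel-injective coordinateMatrix coordinate-matrix-kernel (lookup x) (lookup y) λ j →
      trans (sym (inner-as-dotʳ (Δ j) x)) (trans (same j) (inner-as-dotʳ (Δ j) y)))

  coordinate-system : (b : Vector ℚ ℓ) → ∃ λ x → ∀ j → dot (coordinateMatrix j) x ≡ b j
  coordinate-system = solve-system coordinateMatrix coordinate-matrix-kernel

  withCoordinates : Vector ℚ ℓ → Vect ℓ
  withCoordinates b = tabulate (proj₁ (coordinate-system b))

  withCoordinates-spec : ∀ b j → Δ j · withCoordinates b ≡ b j
  withCoordinates-spec b j = trans (inner-as-dotʳ (Δ j) (withCoordinates b))
    (trans (dot-congʳ (uG (Δ j)) (VecP.lookup∘tabulate (proj₁ (coordinate-system b))))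
           (proj₂ (coordinate-system b) j))

module LatticePoints {ℓ} (R : RootSystem ℓ) (Δ : Fin ℓ → Vect ℓ) (base : RootSystem.IsBase R Δ)
  (α̃ : Vect ℓ) (c : Fin ℓ → ℤ) (highest : RootSystem.IsHighestRoot R Δ α̃ c) where
  open import Data.Rational using (_*_)
  open RootSystem R
  open WeightedSimplex
  open IntegersInℚ
  open Vectors
  open Coordinates R Δ base

  highest-root-pairing : ∀ x → α̃ · x ≡ sum (λ k → ι (c k) * (Δ k · x))
  highest-root-pairing x = trans (cong (_· x) (proj₁ (proj₂ highest))) (inner-lincomb (λ k → ι (c k)) Δ x)

  -- Every coefficient c_k is at least 1: α_k is a root with coefficient vector e_k,
  -- and α̃ dominates it.
  coefficient-positive : ∀ k → 1ℤ ℤ.≤ c k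
  coefficient-positive k = subst (ℤ._≤ c k) (unit-diagonal k)
    (proj₂ (proj₂ highest) (proj₁ base k) (unit k) (sym (unit-lincomb Δ k)) k)

  point : Vec ℕ ℓ → Vect ℓ
  point n = withCoordinates (λ k → ι (+ lookup n k))

  point-coordinate : ∀ n k → Δ k · point n ≡ ι (+ lookup n k)
  point-coordinate n = withCoordinates-spec (λ k → ι (+ lookup n k))

  point-injective : Injective _≡_ _≡_ point
  point-injective {n} {m} eq = vec-ext λ k → ℤP.+-injective (ι-injective
    (trans (sym (point-coordinate n k)) (trans (cong (Δ k ·_) eq) (point-coordinate m k))))

  highest-root-on-point : ∀ x n → (∀ k → Δ k · x ≡ ι (+ lookup n k)) → α̃ · x ≡ ι (weight c n)
  highest-root-on-point x n coords =
    trans (highest-root-pairing x) (trans (sum-cong-≗ (λ k → cong (ι (c k) *_) (coords k))) (ι-weight c n))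

  LatticePoint : ℤ → Vect ℓ → Set
  LatticePoint q x = InCoweight Δ x × InScaledAlcove Δ α̃ q x

  point-in-alcove : ∀ q n → InSimplex c q n → LatticePoint q (point n)
  point-in-alcove q n n∈ =
    (λ k → + lookup n k , point-coordinate n k) ,
    (λ k → subst (0ℚ ℚ.≤_) (sym (point-coordinate n k)) (ι-mono {+ 0} {+ lookup n k} (+≤+ z≤n))) ,
    subst (ℚ._≤ ι q) (sym (highest-root-on-point (point n) n (point-coordinate n))) (ι-mono n∈)

  alcove-point : ∀ q x → LatticePoint q x → ∃ λ n → InSimplex c q n × x ≡ point n
  alcove-point q x (integral , nonneg , below) = n , n∈ , x≡
    where
    coordinate : Fin ℓ → ℕ
    coordinate k = ℤ.∣ proj₁ (integral k) ∣
    n : Vec ℕ ℓ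
    n = tabulate coordinate
    coords : ∀ k → Δ k · x ≡ ι (+ lookup n k)
    coords k = trans (proj₂ (integral k)) (cong ι (begin
      z             ≡⟨ sym (ℤP.0≤i⇒+∣i∣≡i z≥0) ⟩
      + ℤ.∣ z ∣     ≡⟨ cong +_ (sym (VecP.lookup∘tabulate coordinate k)) ⟩
      + lookup n k  ∎))
      where
      open ≡-Reasoning
      z : ℤ
      z = proj₁ (integral k)
      z≥0 : 0ℤ ℤ.≤ z
      z≥0 = ι-cancel-≤ {+ 0} {z} (subst (0ℚ ℚ.≤_) (proj₂ (integral k)) (nonneg k))
    n∈ : InSimplex c q n
    n∈ = ι-cancel-≤ {weight c n} (subst (ℚ._≤ ι q) (highest-root-on-point x n coords) below)
    x≡ : x ≡ point n
    x≡ = coordinates-injective x (point n) λ k → trans (coords k) (sym (point-coordinate n k))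

  facet-point : ∀ q i n → OnFacet Δ α̃ q i (point n) ⇔ OnSimplexFacet c q i n
  facet-point q zero n = mk⇔
    (λ on → ι-injective (trans (sym (highest-root-on-point (point n) n (point-coordinate n))) on))
    (λ on → trans (highest-root-on-point (point n) n (point-coordinate n)) (cong ι on))
  facet-point q (suc j) n = mk⇔
    (λ on → ℤP.+-injective (ι-injective (trans (sym (point-coordinate n j)) on)))
    (λ on → trans (point-coordinate n j) (cong (ι ∘ +_) on))

  OffFacetPoint : Fin (suc ℓ) → ℤ → Vect ℓ → Set
  OffFacetPoint i q x = InCoweight Δ x × InScaledAlcove Δ α̃ q x × ¬ OnFacet Δ α̃ q i x

  off-facet-into : ∀ i q n → InSimplex c q n × ¬ OnSimplexFacet c q i n → OffFacetPoint i q (point n)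
  off-facet-into i q n (n∈ , off) =
    proj₁ (point-in-alcove q n n∈) , proj₂ (point-in-alcove q n n∈) ,
    off ∘ Equivalence.to (facet-point q i n)

  off-facet-onto : ∀ i q x → OffFacetPoint i q x →
    ∃ λ n → (InSimplex c q n × ¬ OnSimplexFacet c q i n) × x ≡ point n
  off-facet-onto i q x (integral , inside , off) = n , (n∈ , off-n) , x≡
    where
    image : ∃ λ n → InSimplex c q n × x ≡ point n
    image = alcove-point q x (integral , inside)
    n : Vec ℕ ℓ
    n = proj₁ image
    n∈ : InSimplex c q n
    n∈ = proj₁ (proj₂ image)
    x≡ : x ≡ point n
    x≡ = proj₂ (proj₂ image)
    off-n : ¬ OnSimplexFacet c q i n
    off-n = off ∘ subst (OnFacet Δ α̃ q i) (sym x≡) ∘ Equivalence.from (facet-point q i n)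

open import Data.Integer using (_-_; _<_)
open Enumeration using (enumerates-map)
open WeightedSimplex using (simplexPoints; shift; simplex-enumerated; off-facet-enumerated)

-- Both lists are images of the enumeration of the simplex of size q - c_i: the
-- points off F_i under point ∘ shift i, those of (q - c_i) Ā under point.
lemma3p3 : ∀ {ℓ : ℕ} (R : RootSystem ℓ) → RootSystem.Irreducible R →
  (Δ : Fin ℓ → Vect ℓ) → RootSystem.IsBase R Δ →
  (α̃ : Vect ℓ) (c : Fin ℓ → ℤ) → RootSystem.IsHighestRoot R Δ α̃ c →
  (i : Fin (suc ℓ)) (q : ℤ) → extCoeff c i < q →
  ∃ λ (xs : List (Vect ℓ)) → ∃ λ (ys : List (Vect ℓ)) →
    Enumerates (λ x → RootSystem.InCoweight R Δ x ×
                      RootSystem.InScaledAlcove R Δ α̃ q x ×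
                      ¬ RootSystem.OnFacet R Δ α̃ q i x) xs ×
    Enumerates (λ x → RootSystem.InCoweight R Δ x ×
                      RootSystem.InScaledAlcove R Δ α̃ (q - extCoeff c i) x) ys ×
    length xs ≡ length ys
lemma3p3 {ℓ} R _ Δ base α̃ c highest i q _ =
  map point (map (shift i) simplex) , map point simplex ,
  enumerates-map point point-injective (off-facet-enumerated coefficient-positive i q)
                 (off-facet-into i q) (off-facet-onto i q) ,
  enumerates-map point point-injective (simplex-enumerated coefficient-positive (q - extCoeff c i))
                 (point-in-alcove (q - extCoeff c i)) (alcove-point (q - extCoeff c i)) ,
  same-length
  where
  open LatticePoints R Δ base α̃ c highest
  simplex : List (Vec ℕ ℓ)
  simplex = simplexPoints c (q - extCoeff c i)
  same-length : length (map point (map (shift i) simplex)) ≡ length (map point simplex)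
  same-length = begin
    length (map point (map (shift i) simplex)) ≡⟨ length-map point (map (shift i) simplex) ⟩
    length (map (shift i) simplex)             ≡⟨ length-map (shift i) simplex ⟩
    length simplex                             ≡⟨ sym (length-map point simplex) ⟩
    length (map point simplex)                 ∎
    where open ≡-Reasoning
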